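{- A graph $G$ has an exact-distance square root if and only if $G$ is equal, as a labelled graph, to $\overline{G}^{[\sharp 2]}$, the exact-distance square of the complement $\overline{G}$ of $G$.
   Context: All graphs are finite and simple. For a graph $H=(V,E)$, its exact-distance square $H^{[\sharp 2]}$ is the graph with vertex set $V$ in which distinct vertices $x,y$ are adjacent if and only if their distance in $H$ is exactly $2$. A graph $H$ is an exact-distance square root of $G$ if $V(H)=V(G)$ and $H^{[\sharp 2]}=G$ (as labelled graphs). $\overline{G}$ denotes the complement of $G$ (same vertex set, distinct vertices adjacent iff they are non-adjacent in $G$). -}

module Defs where

open import Data.Nat using (ℕ)
open import Data.Fin using (Fin)
open import Data.Product using (_×_; _,_; ∃-syntax)
open import Relation.Nullary using (¬_; Dec; yes; no)
open import Relation.Nullary.Decidable using (_×-dec_; ¬?)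
open import Data.Fin using (_≟_)
open import Data.Fin.Properties using (any?)
open import Relation.Binary.PropositionalEquality using (_≡_; _≢_; sym)
open import Function.Bundles using (_⇔_)

record Graph (n : ℕ) : Set₁ where
  field
    Adj     : Fin n → Fin n → Set
    Adj-sym : ∀ {x y} → Adj x y → Adj y x
    Adj-irr : ∀ {x} → ¬ Adj x x
    Adj-dec : ∀ x y → Dec (Adj x y)
open Graph public

_≅_ : ∀ {n} → Graph n → Graph n → Set
G ≅ H = ∀ x y → Adj G x y ⇔ Adj H x y

complement : ∀ {n} → Graph n → Graph n
complement G = record
  { Adj     = λ x y → x ≢ y × ¬ Adj G x y
  ; Adj-sym = λ { (x≢y , ¬a) → (λ e → x≢y (sym e)) , (λ a → ¬a (Adj-sym G a)) }
  ; Adj-irr = λ { (x≢x , _) → x≢x _≡_.refl }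
  ; Adj-dec = λ x y → ¬? (x ≟ y) ×-dec ¬? (Adj-dec G x y)
  }

-- dist_H(x,y) = 2 exactly: x ≠ y, not adjacent (distance ≠ 0,1), and there
-- is a path of length 2 (a common neighbour).
Dist2 : ∀ {n} → Graph n → Fin n → Fin n → Set
Dist2 H x y = x ≢ y × ¬ Adj H x y × ∃[ z ] (Adj H x z × Adj H z y)

exactSq : ∀ {n} → Graph n → Graph n
exactSq H = record
  { Adj     = Dist2 H
  ; Adj-sym = λ { (x≢y , ¬a , z , a₁ , a₂) →
                  (λ e → x≢y (sym e)) , (λ a → ¬a (Adj-sym H a))
                  , z , Adj-sym H a₂ , Adj-sym H a₁ }
  ; Adj-irr = λ { (x≢x , _) → x≢x _≡_.refl }
  ; Adj-dec = λ x y → ¬? (x ≟ y) ×-dec (¬? (Adj-dec H x y)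
                ×-dec any? (λ z → Adj-dec H x z ×-dec Adj-dec H z y))
  }

IsExactSqRoot : ∀ {n} → Graph n → Graph n → Set
IsExactSqRoot H G = exactSq H ≅ G

-- If H is a root of G, every edge of H joins vertices at H-distance 1, hence
-- non-adjacent in G: so H is a spanning subgraph of the complement of G. Any
-- H-path of length 2 between G-adjacent vertices is then also a path in the
-- complement, whose endpoints are non-adjacent there; and conversely vertices
-- at distance 2 in the complement are non-adjacent in it, i.e. adjacent in G.
-- Hence G = (complement G)^[♯2], and the complement itself is then a root.
module Submission where

open import Defs
open import Data.Nat using (ℕ)
open import Data.Product using (∃-syntax; _,_)
open import Function.Bundles using (_⇔_; mk⇔; Equivalence)
open import Relation.Nullary using (¬_; yes; no; contradiction)
open import Relation.Binary.PropositionalEquality using (refl)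

private
  variable
    n : ℕ

_⊆_ : Graph n → Graph n → Set
H ⊆ K = ∀ {x y} → Adj H x y → Adj K x y

≅-sym : {G H : Graph n} → G ≅ H → H ≅ G
≅-sym G≅H x y = mk⇔ (Equivalence.from (G≅H x y)) (Equivalence.to (G≅H x y))

Dist2-mono : {H K : Graph n} → H ⊆ K → ∀ {x y} → ¬ Adj K x y →
             Dist2 H x y → Dist2 K x y
Dist2-mono H⊆K ¬xKy (x≢y , _ , z , xHz , zHy) = x≢y , ¬xKy , z , H⊆K xHz , H⊆K zHy

Dist2-complement⇒Adj : (G : Graph n) → ∀ {x y} →
                       Dist2 (complement G) x y → Adj G x y
Dist2-complement⇒Adj G {x} {y} (x≢y , ¬xG̅y , _) with Adj-dec G x y
... | yes xGy = xGy
... | no ¬xGy = contradiction (x≢y , ¬xGy) ¬xG̅y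

Adj⇒¬Adj-complement : (G : Graph n) → ∀ {x y} →
                      Adj G x y → ¬ Adj (complement G) x y
Adj⇒¬Adj-complement G xGy (_ , ¬xGy) = ¬xGy xGy

Dist2⇒¬Adj : (H : Graph n) → ∀ {x y} → Dist2 H x y → ¬ Adj H x y
Dist2⇒¬Adj H (_ , ¬xHy , _) = ¬xHy

root⊆complement : {H G : Graph n} → IsExactSqRoot H G → H ⊆ complement G
root⊆complement {H = H} root {x} {y} xHy =
    (λ { refl → Adj-irr H xHy })
  , (λ xGy → Dist2⇒¬Adj H (Equivalence.from (root x y) xGy) xHy)

theorem1 : ∀ {n} (G : Graph n) →
    (∃[ H ] IsExactSqRoot H G) ⇔ (G ≅ exactSq (complement G))
theorem1 G = mk⇔ root⇒self-root
  (λ G≅ → complement G , ≅-sym {G = G} {H = exactSq (complement G)} G≅)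
  where
  root⇒self-root : ∃[ H ] IsExactSqRoot H G → G ≅ exactSq (complement G)
  root⇒self-root (H , root) x y = mk⇔
    (λ xGy → Dist2-mono {H = H} {K = complement G}
                        (root⊆complement {H = H} {G = G} root)
                        (Adj⇒¬Adj-complement G xGy)
                        (Equivalence.from (root x y) xGy))
    (Dist2-complement⇒Adj G)
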